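{- Let $w\geq 2$ and $t\geq 512\ln w$. Let $X\in(\{0,1\}^w)^t$ and $\Sigma=(\sigma^1,\dots,\sigma^t)\in(\mathcal S_w)^t$ be uniformly random. For each $i\in[t]$, let $(f^i_L,f^i_M,f^i_R)$ be functions $[2w]\to\{\alpha,\beta\}$, chosen uniformly at random, with everything independent. Let $G=\mathrm{MultiBlock}(X,\Sigma)$ with blocks $B_1,\dots,B_t$, where block $B_i$ uses the functions $(f^i_L,f^i_M,f^i_R)$. Then, with probability at least $1-1/w^2$, at least $\ln w$ of the blocks are active.
   Context: $\mathrm{MultiBlock}(X,\Sigma)$ is the concatenation (identifying the last layer of one with the first layer of the next) of blocks $B_i=\mathrm{Block}(x^i,\sigma^i)$. Each block has four layers, each a copy of $[2w]$ partitioned into groups $(a_j,b_j)$, $j\in[w]$. Its edges are: - group $j$ of layer 1 matched to group $\sigma(j)$ of layer 2 ($a$ to $a$, $b$ to $b$); - group $j$ of layer 2 matched to group $j$ of layer 3, straight if $x_j=0$ and crossed if $x_j=1$; - group $j$ of layer 3 matched to group $\sigma^{ -1}(j)$ of layer 4. For block $B_i$, $\mathrm{clean}(B_i)$ is the set of $j\in[w]$ with $f^i_L(a^2_j)=f^i_L(b^2_j)=\beta$, $f^i_M(a^2_j)=f^i_M(b^2_j)=\alpha$, and $f^i_R(a^3_j)=f^i_R(b^3_j)=\beta$, where $a^2_j,b^2_j$ are group $j$ of layer 2 and $a^3_j,b^3_j$ are group $j$ of layer 3. Block $B_i$ is active if $\sigma^i(1)\in\mathrm{clean}(B_i)$. 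-}

module Defs where

open import Data.Nat using (ℕ; zero; suc; _+_; _*_; _^_; _≤_; _≤?_; _!)
open import Data.Bool using (Bool; true; false)
open import Data.Fin using (Fin; zero; suc)
import Data.Fin.Properties as FinP
open import Data.Vec using (Vec; []; _∷_)
open import Data.List using (List; []; _∷_; map; concatMap; length; filter)
open import Data.Product using (Σ; _×_; _,_; ∃)
open import Relation.Nullary using (Dec; yes; no)
open import Relation.Nullary.Decidable using (_×-dec_; _→-dec_)
open import Relation.Unary using (Pred; Decidable)
open import Relation.Binary.PropositionalEquality using (_≡_; refl)

-- Natural logarithm thresholds, without reals.
-- expSum k n = n! * Σ_{j=0}^{n} k^j / j!   (a natural number)
-- so  expSum k n / n!  is the n-th partial sum of the series of e^k.

expSum : ℕ → ℕ → ℕ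
expSum k zero    = 1
expSum k (suc n) = suc n * expSum k n + k ^ suc n

-- LnAtMost m k  means  ln m ≤ k  (i.e. m ≤ e^k), for naturals m ≥ 1, k.
-- Since the partial sums increase strictly to e^k, m ≤ e^k holds iff
-- some partial sum is ≥ m (e^k = m only for k = 0, m = 1, witnessed by n = 0).
LnAtMost : ℕ → ℕ → Set
LnAtMost m k = ∃ λ n → m * (n !) ≤ expSum k n

data AB : Set where
  α β : AB

_≟AB_ : (x y : AB) → Dec (x ≡ y)
α ≟AB α = yes refl
α ≟AB β = no λ ()
β ≟AB α = no λ ()
β ≟AB β = yes refl

data Side : Set where
  a b : Side

-- A layer is a copy of [2w], represented as Fin w × Side:
-- the vertex (j , a) is a_j and (j , b) is b_j.
-- A function [2w] → {α,β} is represented (curried) as Fin w → Side → AB.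
Labelling : ℕ → Set
Labelling w = Fin w → Side → AB

-- All the randomness of one block B_i: x^i, σ^i, f^i_L, f^i_M, f^i_R.
-- σ is a map Fin w → Fin w; it ranges over S_w when injective.
record BlockData (w : ℕ) : Set where
  constructor blk
  field
    x  : Fin w → Bool
    σ  : Fin w → Fin w
    fL : Labelling w
    fM : Labelling w
    fR : Labelling w
open BlockData public

IsPerm : ∀ {w} → (Fin w → Fin w) → Set
IsPerm {w} σ = (i j : Fin w) → σ i ≡ σ j → i ≡ j

isPerm? : ∀ {w} (σ : Fin w → Fin w) → Dec (IsPerm σ)
isPerm? σ = FinP.all? λ i → FinP.all? λ j → FinP._≟_ (σ i) (σ j) →-dec FinP._≟_ i j

-- j ∈ clean(B): f_L(a²_j)=f_L(b²_j)=β, f_M(a²_j)=f_M(b²_j)=α, f_R(a³_j)=f_R(b³_j)=β.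
-- (layer-2 and layer-3 vertices of group j are (j , a), (j , b) in their layer)
Clean : ∀ {w} → BlockData w → Fin w → Set
Clean B j =
  (fL B j a ≡ β × fL B j b ≡ β) ×
  (fM B j a ≡ α × fM B j b ≡ α) ×
  (fR B j a ≡ β × fR B j b ≡ β)

clean? : ∀ {w} (B : BlockData w) (j : Fin w) → Dec (Clean B j)
clean? B j =
  ((fL B j a ≟AB β) ×-dec (fL B j b ≟AB β)) ×-dec
  ((fM B j a ≟AB α) ×-dec (fM B j b ≟AB α)) ×-dec
  ((fR B j a ≟AB β) ×-dec (fR B j b ≟AB β))

-- The element 1 of [w] (Fin uses 0-based indexing).
one : ∀ {w} → 2 ≤ w → Fin w
one {suc w} _ = zero

Active : ∀ {w} → 2 ≤ w → BlockData w → Set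
Active h B = Clean B (σ B (one h))

active? : ∀ {w} (h : 2 ≤ w) (B : BlockData w) → Dec (Active h B)
active? h B = clean? B (σ B (one h))

numActive : ∀ {w t} → 2 ≤ w → Vec (BlockData w) t → ℕ
numActive h [] = 0
numActive h (B ∷ Bs) with active? h B
... | yes _ = suc (numActive h Bs)
... | no  _ = numActive h Bs

AllPerm : ∀ {w t} → Vec (BlockData w) t → Set
AllPerm [] = Data.Unit.⊤
  where import Data.Unit
AllPerm (B ∷ Bs) = IsPerm (σ B) × AllPerm Bs

allPerm? : ∀ {w t} (Bs : Vec (BlockData w) t) → Dec (AllPerm Bs)
allPerm? [] = yes _
allPerm? (B ∷ Bs) = isPerm? (σ B) ×-dec allPerm? Bs

allFuns : ∀ {A : Set} (n : ℕ) → List A → List (Fin n → A)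
allFuns zero    xs = (λ ()) ∷ []
allFuns (suc n) xs =
  concatMap (λ x → map (λ f → λ { zero → x ; (suc i) → f i }) (allFuns n xs)) xs

allFin : (n : ℕ) → List (Fin n)
allFin zero = []
allFin (suc n) = zero ∷ map suc (allFin n)

allSideFuns : List (Side → AB)
allSideFuns = map (λ p → λ { a → Data.Product.proj₁ p ; b → Data.Product.proj₂ p })
                  ((α , α) ∷ (α , β) ∷ (β , α) ∷ (β , β) ∷ [])
  where import Data.Product

allBlocks : (w : ℕ) → List (BlockData w)
allBlocks w =
  concatMap (λ x → concatMap (λ s → concatMap (λ l → concatMap (λ m →
    map (λ r → blk x s l m r) labs) labs) labs) (allFuns w (allFin w)))
    (allFuns w (true ∷ false ∷ []))
  where
    labs : List (Labelling w)
    labs = allFuns w allSideFuns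

allVecs : ∀ {A : Set} (t : ℕ) → List A → List (Vec A t)
allVecs zero    xs = [] ∷ []
allVecs (suc t) xs = concatMap (λ x → map (x ∷_) (allVecs t xs)) xs

-- The sample space: (X, Σ, (f^i_L, f^i_M, f^i_R)_i) with X ∈ ({0,1}^w)^t,
-- Σ ∈ (S_w)^t, f's arbitrary; each outcome listed exactly once.
outcomes : (w t : ℕ) → List (Vec (BlockData w) t)
outcomes w t = filter allPerm? (allVecs t (allBlocks w))

goodCount : (w t : ℕ) → 2 ≤ w → ℕ → ℕ
goodCount w t h k = length (filter (λ Bs → k ≤? numActive h Bs) (outcomes w t))

-- A block is active with probability exactly 1/64: σ(1) is some group j, and j is clean iff
-- the six independent uniform labels f_L(a²_j), f_L(b²_j), f_M(a²_j), f_M(b²_j), f_R(a³_j),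
-- f_R(b³_j) take prescribed values.  The blocks are independent, so the weight
-- 2^(number of inactive blocks) sums to (127/64)^t times the number of outcomes, and Markov's
-- inequality bounds the fraction of outcomes with at most k - 1 active blocks by
-- 2^(k-1) (127/128)^t.  Minimality of k gives 2^(k-1) ≤ e^(k-1) < w, and t ≥ 512 ln w together
-- with e ≤ 27/8 gives (127/128)^t ≤ w^(-3).

module Submission where

open import Data.Bool using (Bool; true; false; not; _∧_; T; if_then_else_)
open import Data.Fin using (Fin; zero; suc)
open import Data.List using (List; []; _∷_; _++_; map; concatMap; length; filter)
open import Data.List.Properties using (filter-++)
open import Data.Nat
open import Data.Nat.Properties
open import Algebra.Properties.CommutativeSemigroup +-commutativeSemigroup
  using () renaming (interchange to +-interchange)
open import Algebra.Properties.CommutativeSemigroup *-commutativeSemigroup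
  using (x∙yz≈y∙xz; xy∙z≈y∙xz) renaming (interchange to *-interchange)
open import Data.Nat.Tactic.RingSolver using (solve-∀)
open import Data.Product using (_,_)
open import Data.Vec using (Vec; []; _∷_)
open import Relation.Nullary using (¬_; yes; no; does)
open import Relation.Nullary.Decidable using (dec-true; dec-false)
open import Relation.Unary using (Decidable)
open import Relation.Binary.PropositionalEquality
open import Defs

^-distribʳ-* : ∀ m n o → (m * n) ^ o ≡ m ^ o * n ^ o
^-distribʳ-* m n zero    = refl
^-distribʳ-* m n (suc o) =
  trans (cong (m * n *_) (^-distribʳ-* m n o)) (*-interchange m n (m ^ o) (n ^ o))

^-swap : ∀ m n o → (m ^ n) ^ o ≡ (m ^ o) ^ n
^-swap m n o = begin
  (m ^ n) ^ o  ≡⟨ ^-*-assoc m n o ⟩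
  m ^ (n * o)  ≡⟨ cong (m ^_) (*-comm n o) ⟩
  m ^ (o * n)  ≡⟨ ^-*-assoc m o n ⟨
  (m ^ o) ^ n  ∎
  where open ≡-Reasoning

^≤expSum : ∀ m n → m ^ n ≤ expSum m n
^≤expSum m zero    = ≤-refl
^≤expSum m (suc n) = m≤n+m (m ^ suc n) (suc n * expSum m n)

-- (1 + 1/c)^q ≥ 1 + q/c, cleared of denominators.
bernoulli : ∀ c q → c ^ q * (c + q) ≤ c * suc c ^ q
bernoulli c zero    = ≤-reflexive (trans (*-identityˡ (c + 0)) (trans (+-identityʳ c) (sym (*-identityʳ c))))
bernoulli c (suc q) = begin
  c * c ^ q * (c + suc q)                ≤⟨ m≤m+n _ _ ⟩
  c * c ^ q * (c + suc q) + c ^ q * q    ≡⟨ regroup c (c ^ q) q ⟩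
  suc c * (c ^ q * (c + q))              ≤⟨ *-monoʳ-≤ (suc c) (bernoulli c q) ⟩
  suc c * (c * suc c ^ q)                ≡⟨ x∙yz≈y∙xz (suc c) c (suc c ^ q) ⟩
  c * (suc c * suc c ^ q)                ∎
  where
    open ≤-Reasoning
    regroup : ∀ c p q → c * p * (c + suc q) + p * q ≡ suc c * (p * (c + q))
    regroup = solve-∀

2*[1+n]^[1+n]≤[2+n]^[1+n] : ∀ n → 2 * suc n ^ suc n ≤ suc (suc n) ^ suc n
2*[1+n]^[1+n]≤[2+n]^[1+n] n =
  *-cancelˡ-≤ (suc n) (subst (_≤ suc n * suc (suc n) ^ suc n)
                             (regroup (suc n) (suc n ^ suc n))
                             (bernoulli (suc n) (suc n)))
  where
    regroup : ∀ c p → p * (c + c) ≡ c * (2 * p)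
    regroup = solve-∀

2^n*n!≤[1+n]^n : ∀ n → 2 ^ n * n ! ≤ suc n ^ n
2^n*n!≤[1+n]^n zero    = ≤-refl
2^n*n!≤[1+n]^n (suc n) = begin
  2 * 2 ^ n * (suc n * n !)   ≡⟨ regroup (suc n) (2 ^ n) (n !) ⟩
  2 * suc n * (2 ^ n * n !)   ≤⟨ *-monoʳ-≤ (2 * suc n) (2^n*n!≤[1+n]^n n) ⟩
  2 * suc n * suc n ^ n       ≡⟨ *-assoc 2 (suc n) (suc n ^ n) ⟩
  2 * suc n ^ suc n           ≤⟨ 2*[1+n]^[1+n]≤[2+n]^[1+n] n ⟩
  suc (suc n) ^ suc n         ∎
  where
    open ≤-Reasoning
    regroup : ∀ c p q → 2 * p * (c * q) ≡ 2 * c * (p * q)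
    regroup = solve-∀

-- Only the last two terms n^(n-1)/(n-1)! + n^n/n! of the partial sum are needed.
2^n*n!≤expSum-n-n : ∀ n → 2 ^ n * n ! ≤ expSum n n
2^n*n!≤expSum-n-n zero    = ≤-refl
2^n*n!≤expSum-n-n (suc n) = begin
  2 * 2 ^ n * (suc n * n !)                  ≡⟨ regroup (suc n) (2 ^ n) (n !) ⟩
  2 * suc n * (2 ^ n * n !)                  ≤⟨ *-monoʳ-≤ (2 * suc n) (2^n*n!≤[1+n]^n n) ⟩
  2 * suc n * suc n ^ n                      ≡⟨ double (suc n) (suc n ^ n) ⟩
  suc n * suc n ^ n + suc n ^ suc n          ≤⟨ +-monoˡ-≤ (suc n ^ suc n)
                                                  (*-monoʳ-≤ (suc n) (^≤expSum (suc n) n)) ⟩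
  suc n * expSum (suc n) n + suc n ^ suc n   ∎
  where
    open ≤-Reasoning
    regroup : ∀ c p q → 2 * p * (c * q) ≡ 2 * c * (p * q)
    regroup = solve-∀
    double : ∀ c p → 2 * c * p ≡ c * p + c * p
    double = solve-∀

¬LnAtMost⇒2^k<m : ∀ m k → ¬ LnAtMost m k → 2 ^ k < m
¬LnAtMost⇒2^k<m m k ¬ln = ≰⇒> λ m≤2^k →
  ¬ln (k , ≤-trans (*-monoˡ-≤ (k !) m≤2^k) (2^n*n!≤expSum-n-n k))

-- scaledExpSum s n = 3^n n! Σ_{j ≤ n} (s/3)^j / j!
scaledExpSum : ℕ → ℕ → ℕ
scaledExpSum s zero    = 1
scaledExpSum s (suc n) = 3 * suc n * scaledExpSum s n + s ^ suc n

[1+s]^[1+n]≤s^[1+n]+[1+n]*[1+s]^n : ∀ s n → suc s ^ suc n ≤ s ^ suc n + suc n * suc s ^ n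
[1+s]^[1+n]≤s^[1+n]+[1+n]*[1+s]^n s zero    = ≤-reflexive (base s)
  where
    base : ∀ s → suc s * 1 ≡ s * 1 + 1 * 1
    base = solve-∀
[1+s]^[1+n]≤s^[1+n]+[1+n]*[1+s]^n s (suc n) = begin
  suc s * suc s ^ suc n                                    ≤⟨ *-monoʳ-≤ (suc s) ([1+s]^[1+n]≤s^[1+n]+[1+n]*[1+s]^n s n) ⟩
  suc s * (s ^ suc n + suc n * suc s ^ n)                  ≡⟨ expand s (s ^ suc n) (suc s ^ n) n ⟩
  s * s ^ suc n + s ^ suc n + suc n * (suc s * suc s ^ n)  ≤⟨ +-monoˡ-≤ _ (+-monoʳ-≤ (s * s ^ suc n)
                                                                (^-monoˡ-≤ (suc n) (n≤1+n s))) ⟩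
  s * s ^ suc n + suc s ^ suc n + suc n * suc s ^ suc n    ≡⟨ collect (s * s ^ suc n) (suc s ^ suc n) n ⟩
  s * s ^ suc n + suc (suc n) * suc s ^ suc n              ∎
  where
    open ≤-Reasoning
    expand : ∀ s p q n → suc s * (p + suc n * q) ≡ s * p + p + suc n * (suc s * q)
    expand = solve-∀
    collect : ∀ p q n → p + q + suc n * q ≡ p + suc (suc n) * q
    collect = solve-∀

scaledExpSum-suc-mean-value : ∀ s n →
  scaledExpSum (suc s) (suc n) ≤ scaledExpSum s (suc n) + suc n * scaledExpSum (suc s) n
scaledExpSum-suc-mean-value s zero    = ≤-reflexive (base s)
  where
    base : ∀ s → 3 * 1 * 1 + suc s * 1 ≡ 3 * 1 * 1 + s * 1 + 1 * 1
    base = solve-∀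
scaledExpSum-suc-mean-value s (suc n) = begin
  3 * suc (suc n) * scaledExpSum (suc s) (suc n) + suc s ^ suc (suc n)
    ≤⟨ +-mono-≤ (*-monoʳ-≤ (3 * suc (suc n)) (scaledExpSum-suc-mean-value s n))
                ([1+s]^[1+n]≤s^[1+n]+[1+n]*[1+s]^n s (suc n)) ⟩
  3 * suc (suc n) * (scaledExpSum s (suc n) + suc n * scaledExpSum (suc s) n)
    + (s ^ suc (suc n) + suc (suc n) * suc s ^ suc n)
    ≡⟨ regroup n (scaledExpSum s (suc n)) (scaledExpSum (suc s) n) (s ^ suc (suc n)) (suc s ^ suc n) ⟩
  3 * suc (suc n) * scaledExpSum s (suc n) + s ^ suc (suc n)
    + suc (suc n) * (3 * suc n * scaledExpSum (suc s) n + suc s ^ suc n)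
    ∎
  where
    open ≤-Reasoning
    regroup : ∀ n p q r u → 3 * suc (suc n) * (p + suc n * q) + (r + suc (suc n) * u)
                          ≡ 3 * suc (suc n) * p + r + suc (suc n) * (3 * suc n * q + u)
    regroup = solve-∀

-- With F = scaledExpSum: (n+1)·F(s+1, n) ≤ F(s+1, n+1)/3, so the mean-value step gives
-- F(s+1, n+1) ≤ (3/2)·F(s, n+1).
scaledExpSum-ratio : ∀ s n → 2 * scaledExpSum (suc s) n ≤ 3 * scaledExpSum s n
scaledExpSum-ratio s zero    = s≤s (s≤s z≤n)
scaledExpSum-ratio s (suc n) = +-cancelʳ-≤ X (2 * X) (3 * F s (suc n)) (begin
  2 * X + X                                ≡⟨ twice+once X ⟩
  3 * X                                    ≤⟨ *-monoʳ-≤ 3 (scaledExpSum-suc-mean-value s n) ⟩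
  3 * (F s (suc n) + suc n * Y)            ≡⟨ *-distribˡ-+ 3 (F s (suc n)) (suc n * Y) ⟩
  3 * F s (suc n) + 3 * (suc n * Y)        ≤⟨ +-monoʳ-≤ (3 * F s (suc n))
                                                (≤-trans (≤-reflexive (sym (*-assoc 3 (suc n) Y))) (m≤m+n _ _)) ⟩
  3 * F s (suc n) + X                      ∎)
  where
    open ≤-Reasoning
    F = scaledExpSum
    X = F (suc s) (suc n)
    Y = F (suc s) n
    twice+once : ∀ x → 2 * x + x ≡ 3 * x
    twice+once = solve-∀

2^s*scaledExpSum≤3^s*scaledExpSum-0 : ∀ s n → 2 ^ s * scaledExpSum s n ≤ 3 ^ s * scaledExpSum 0 n
2^s*scaledExpSum≤3^s*scaledExpSum-0 zero    n = ≤-refl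
2^s*scaledExpSum≤3^s*scaledExpSum-0 (suc s) n = begin
  2 * 2 ^ s * F (suc s) n     ≡⟨ xy∙z≈y∙xz 2 (2 ^ s) (F (suc s) n) ⟩
  2 ^ s * (2 * F (suc s) n)   ≤⟨ *-monoʳ-≤ (2 ^ s) (scaledExpSum-ratio s n) ⟩
  2 ^ s * (3 * F s n)         ≡⟨ x∙yz≈y∙xz (2 ^ s) 3 (F s n) ⟩
  3 * (2 ^ s * F s n)         ≤⟨ *-monoʳ-≤ 3 (2^s*scaledExpSum≤3^s*scaledExpSum-0 s n) ⟩
  3 * (3 ^ s * F 0 n)         ≡⟨ *-assoc 3 (3 ^ s) (F 0 n) ⟨
  3 * 3 ^ s * F 0 n           ∎
  where
    open ≤-Reasoning
    F = scaledExpSum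

scaledExpSum-0 : ∀ n → scaledExpSum 0 n ≡ 3 ^ n * n !
scaledExpSum-0 zero    = refl
scaledExpSum-0 (suc n) = trans (cong (λ z → 3 * suc n * z + 0) (scaledExpSum-0 n))
                               (regroup n (3 ^ n) (n !))
  where
    regroup : ∀ n p q → 3 * suc n * (p * q) + 0 ≡ 3 * p * (suc n * q)
    regroup = solve-∀

scaledExpSum-3* : ∀ t n → scaledExpSum (3 * t) n ≡ 3 ^ n * expSum t n
scaledExpSum-3* t zero    = refl
scaledExpSum-3* t (suc n) = begin
  3 * suc n * scaledExpSum (3 * t) n + (3 * t) ^ suc n
    ≡⟨ cong₂ (λ u v → 3 * suc n * u + v) (scaledExpSum-3* t n) (^-distribʳ-* 3 t (suc n)) ⟩
  3 * suc n * (3 ^ n * expSum t n) + 3 * 3 ^ n * (t * t ^ n)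
    ≡⟨ regroup n (3 ^ n) (expSum t n) (t * t ^ n) ⟩
  3 * 3 ^ n * (suc n * expSum t n + t * t ^ n)
    ∎
  where
    open ≡-Reasoning
    regroup : ∀ n p e q → 3 * suc n * (p * e) + 3 * p * q ≡ 3 * p * (suc n * e + q)
    regroup = solve-∀

-- e^t ≤ (27/8)^t, from e^(1/3) ≤ 3/2.
8^t*expSum≤27^t*n! : ∀ t n → 8 ^ t * expSum t n ≤ 27 ^ t * n !
8^t*expSum≤27^t*n! t n = *-cancelˡ-≤ (3 ^ n) {{m^n≢0 3 n}} (begin
  3 ^ n * (8 ^ t * expSum t n)   ≡⟨ x∙yz≈y∙xz (3 ^ n) (8 ^ t) (expSum t n) ⟩
  8 ^ t * (3 ^ n * expSum t n)   ≡⟨ cong₂ _*_ (^-*-assoc 2 3 t) (sym (scaledExpSum-3* t n)) ⟩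
  2 ^ (3 * t) * scaledExpSum (3 * t) n  ≤⟨ 2^s*scaledExpSum≤3^s*scaledExpSum-0 (3 * t) n ⟩
  3 ^ (3 * t) * scaledExpSum 0 n ≡⟨ cong₂ _*_ (sym (^-*-assoc 3 3 t)) (scaledExpSum-0 n) ⟩
  27 ^ t * (3 ^ n * n !)         ≡⟨ x∙yz≈y∙xz (27 ^ t) (3 ^ n) (n !) ⟩
  3 ^ n * (27 ^ t * n !)         ∎)
  where open ≤-Reasoning

-- With w^512 ≤ e^t ≤ (27/8)^t, this reduces to (19683/512)·(127/128)^512 ≤ 1.
LnAtMost⇒w^3*127^t≤128^t : ∀ w t → LnAtMost (w ^ 512) t → w ^ 3 * 127 ^ t ≤ 128 ^ t
LnAtMost⇒w^3*127^t≤128^t w t (n , w^512*n!≤expSum) =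
  ≮⇒≥ (λ 128^t<lhs → <⇒≱ (^-monoˡ-< 512 128^t<lhs) power512)
  where
    open ≤-Reasoning
    8^t*w^512≤27^t : 8 ^ t * w ^ 512 ≤ 27 ^ t
    8^t*w^512≤27^t = *-cancelʳ-≤ _ _ (n !) {{n !≢0}} (begin
      8 ^ t * w ^ 512 * n !     ≡⟨ *-assoc (8 ^ t) (w ^ 512) (n !) ⟩
      8 ^ t * (w ^ 512 * n !)   ≤⟨ *-monoʳ-≤ (8 ^ t) w^512*n!≤expSum ⟩
      8 ^ t * expSum t n        ≤⟨ 8^t*expSum≤27^t*n! t n ⟩
      27 ^ t * n !              ∎)
    512^t*w^1536≤19683^t : 512 ^ t * w ^ 1536 ≤ 19683 ^ t
    512^t*w^1536≤19683^t = begin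
      512 ^ t * w ^ 1536           ≡⟨ cong₂ _*_ (^-swap 8 3 t) (sym (^-*-assoc w 512 3)) ⟩
      (8 ^ t) ^ 3 * (w ^ 512) ^ 3  ≡⟨ ^-distribʳ-* (8 ^ t) (w ^ 512) 3 ⟨
      (8 ^ t * w ^ 512) ^ 3        ≤⟨ ^-monoˡ-≤ 3 8^t*w^512≤27^t ⟩
      (27 ^ t) ^ 3                 ≡⟨ ^-swap 27 t 3 ⟩
      19683 ^ t                    ∎
    constant : 19683 * 127 ^ 512 ≤ 512 * 128 ^ 512
    constant = ≤ᵇ⇒≤ _ _ _
    power512 : (w ^ 3 * 127 ^ t) ^ 512 ≤ (128 ^ t) ^ 512
    power512 = *-cancelˡ-≤ (512 ^ t) {{m^n≢0 512 t}} (begin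
      512 ^ t * (w ^ 3 * 127 ^ t) ^ 512       ≡⟨ cong (512 ^ t *_) (trans (^-distribʳ-* (w ^ 3) (127 ^ t) 512)
                                                   (cong₂ _*_ (^-*-assoc w 3 512) (^-swap 127 t 512))) ⟩
      512 ^ t * (w ^ 1536 * (127 ^ 512) ^ t)  ≡⟨ *-assoc (512 ^ t) (w ^ 1536) ((127 ^ 512) ^ t) ⟨
      512 ^ t * w ^ 1536 * (127 ^ 512) ^ t    ≤⟨ *-monoˡ-≤ ((127 ^ 512) ^ t) 512^t*w^1536≤19683^t ⟩
      19683 ^ t * (127 ^ 512) ^ t             ≡⟨ ^-distribʳ-* 19683 (127 ^ 512) t ⟨
      (19683 * 127 ^ 512) ^ t                 ≤⟨ ^-monoˡ-≤ t constant ⟩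
      (512 * 128 ^ 512) ^ t                   ≡⟨ ^-distribʳ-* 512 (128 ^ 512) t ⟩
      512 ^ t * (128 ^ 512) ^ t               ≡⟨ cong (512 ^ t *_) (^-swap 128 512 t) ⟩
      512 ^ t * (128 ^ t) ^ 512               ∎)

𝟙 : Bool → ℕ
𝟙 true  = 1
𝟙 false = 0

𝟙-∧ : ∀ c d → 𝟙 (c ∧ d) ≡ 𝟙 c * 𝟙 d
𝟙-∧ true  d = sym (+-identityʳ (𝟙 d))
𝟙-∧ false d = refl

𝟙+𝟙-not : ∀ c → 𝟙 c + 𝟙 (not c) ≡ 1
𝟙+𝟙-not true  = refl
𝟙+𝟙-not false = refl

∑ : {A : Set} → List A → (A → ℕ) → ℕ
∑ []       f = 0
∑ (x ∷ xs) f = f x + ∑ xs f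

∑³ : {A : Set} → List A → (A → A → A → ℕ) → ℕ
∑³ xs f = ∑ xs λ x → ∑ xs λ y → ∑ xs λ z → f x y z

module _ {A : Set} where

  ∑-cong : ∀ {f g : A → ℕ} → (∀ x → f x ≡ g x) → ∀ xs → ∑ xs f ≡ ∑ xs g
  ∑-cong f≗g []       = refl
  ∑-cong f≗g (x ∷ xs) = cong₂ _+_ (f≗g x) (∑-cong f≗g xs)

  ∑-mono-≤ : ∀ {f g : A → ℕ} → (∀ x → f x ≤ g x) → ∀ xs → ∑ xs f ≤ ∑ xs g
  ∑-mono-≤ f≤g []       = z≤n
  ∑-mono-≤ f≤g (x ∷ xs) = +-mono-≤ (f≤g x) (∑-mono-≤ f≤g xs)

  ∑-++ : ∀ (f : A → ℕ) xs ys → ∑ (xs ++ ys) f ≡ ∑ xs f + ∑ ys f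
  ∑-++ f []       ys = refl
  ∑-++ f (x ∷ xs) ys = trans (cong (f x +_) (∑-++ f xs ys)) (sym (+-assoc (f x) _ _))

  ∑-const : ∀ c (xs : List A) → ∑ xs (λ _ → c) ≡ length xs * c
  ∑-const c []       = refl
  ∑-const c (x ∷ xs) = cong (c +_) (∑-const c xs)

  ∑-*ˡ : ∀ c (f : A → ℕ) xs → ∑ xs (λ x → c * f x) ≡ c * ∑ xs f
  ∑-*ˡ c f []       = sym (*-zeroʳ c)
  ∑-*ˡ c f (x ∷ xs) = trans (cong (c * f x +_) (∑-*ˡ c f xs)) (sym (*-distribˡ-+ c (f x) _))

  ∑-*ʳ : ∀ c (f : A → ℕ) xs → ∑ xs (λ x → f x * c) ≡ ∑ xs f * c
  ∑-*ʳ c f []       = refl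
  ∑-*ʳ c f (x ∷ xs) = trans (cong (f x * c +_) (∑-*ʳ c f xs)) (sym (*-distribʳ-+ c (f x) _))

  ∑-+ : ∀ (f g : A → ℕ) xs → ∑ xs (λ x → f x + g x) ≡ ∑ xs f + ∑ xs g
  ∑-+ f g []       = refl
  ∑-+ f g (x ∷ xs) = trans (cong (f x + g x +_) (∑-+ f g xs)) (+-interchange (f x) (g x) (∑ xs f) (∑ xs g))

  ∑-concatMap : ∀ {B : Set} (f : A → ℕ) (g : B → List A) xs →
                ∑ (concatMap g xs) f ≡ ∑ xs (λ y → ∑ (g y) f)
  ∑-concatMap f g []       = refl
  ∑-concatMap f g (y ∷ ys) = trans (∑-++ f (g y) (concatMap g ys)) (cong (∑ (g y) f +_) (∑-concatMap f g ys))

  ∑-map : ∀ {B : Set} (f : A → ℕ) (g : B → A) xs → ∑ (map g xs) f ≡ ∑ xs (λ y → f (g y))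
  ∑-map f g []       = refl
  ∑-map f g (y ∷ ys) = cong (f (g y) +_) (∑-map f g ys)

  ∑-filter : ∀ {P : A → Set} (P? : Decidable P) (f : A → ℕ) xs →
             ∑ (filter P? xs) f ≡ ∑ xs (λ x → 𝟙 (does (P? x)) * f x)
  ∑-filter P? f []       = refl
  ∑-filter P? f (x ∷ xs) with does (P? x)
  ... | true  = cong₂ _+_ (sym (+-identityʳ (f x))) (∑-filter P? f xs)
  ... | false = ∑-filter P? f xs

  length≡∑1 : ∀ (xs : List A) → length xs ≡ ∑ xs (λ _ → 1)
  length≡∑1 []       = refl
  length≡∑1 (x ∷ xs) = cong suc (length≡∑1 xs)

  ∑𝟙+∑𝟙-not : ∀ (p : A → Bool) xs → ∑ xs (λ x → 𝟙 (p x)) + ∑ xs (λ x → 𝟙 (not (p x))) ≡ length xs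
  ∑𝟙+∑𝟙-not p xs = begin
    ∑ xs (λ x → 𝟙 (p x)) + ∑ xs (λ x → 𝟙 (not (p x)))  ≡⟨ ∑-+ _ _ xs ⟨
    ∑ xs (λ x → 𝟙 (p x) + 𝟙 (not (p x)))              ≡⟨ ∑-cong (λ x → 𝟙+𝟙-not (p x)) xs ⟩
    ∑ xs (λ _ → 1)                                     ≡⟨ length≡∑1 xs ⟨
    length xs                                          ∎
    where open ≡-Reasoning

  ∑³-* : ∀ (f g h : A → ℕ) xs → ∑³ xs (λ x y z → f x * (g y * h z)) ≡ ∑ xs f * (∑ xs g * ∑ xs h)
  ∑³-* f g h xs = begin
    ∑ xs (λ x → ∑ xs λ y → ∑ xs λ z → f x * (g y * h z))  ≡⟨ ∑-cong (λ x → ∑-cong (λ y → inner x y) xs) xs ⟩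
    ∑ xs (λ x → ∑ xs λ y → f x * (g y * ∑ xs h))          ≡⟨ ∑-cong (λ x → ∑-*ˡ (f x) _ xs) xs ⟩
    ∑ xs (λ x → f x * ∑ xs (λ y → g y * ∑ xs h))          ≡⟨ ∑-cong (λ x → cong (f x *_) (∑-*ʳ (∑ xs h) g xs)) xs ⟩
    ∑ xs (λ x → f x * (∑ xs g * ∑ xs h))                  ≡⟨ ∑-*ʳ _ f xs ⟩
    ∑ xs f * (∑ xs g * ∑ xs h)                            ∎
    where
      open ≡-Reasoning
      inner : ∀ x y → ∑ xs (λ z → f x * (g y * h z)) ≡ f x * (g y * ∑ xs h)
      inner x y = trans (∑-*ˡ (f x) _ xs) (cong (f x *_) (∑-*ˡ (g y) h xs))

  ∑³-*ˡ : ∀ c (f : A → A → A → ℕ) xs → ∑³ xs (λ x y z → c * f x y z) ≡ c * ∑³ xs f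
  ∑³-*ˡ c f xs =
    trans (∑-cong (λ x → trans (∑-cong (λ y → ∑-*ˡ c _ xs) xs) (∑-*ˡ c _ xs)) xs) (∑-*ˡ c _ xs)

  ∑³-const : ∀ c (xs : List A) → ∑³ xs (λ _ _ _ → c) ≡ c * length xs ^ 3
  ∑³-const c xs = begin
    ∑³ xs (λ _ _ _ → c)              ≡⟨ ∑-cong (λ _ → trans (∑-cong (λ _ → ∑-const c xs) xs) (∑-const _ xs)) xs ⟩
    ∑ xs (λ _ → n * (n * c))         ≡⟨ ∑-const _ xs ⟩
    n * (n * (n * c))                ≡⟨ cube n c ⟩
    c * n ^ 3                        ∎
    where
      open ≡-Reasoning
      n = length xs
      cube : ∀ p q → p * (p * (p * q)) ≡ q * (p * (p * (p * 1)))
      cube = solve-∀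

  length-filter≡∑𝟙 : ∀ {P : A → Set} (P? : Decidable P) xs → length (filter P? xs) ≡ ∑ xs (λ x → 𝟙 (does (P? x)))
  length-filter≡∑𝟙 P? xs = begin
    length (filter P? xs)                 ≡⟨ length≡∑1 (filter P? xs) ⟩
    ∑ (filter P? xs) (λ _ → 1)            ≡⟨ ∑-filter P? _ xs ⟩
    ∑ xs (λ x → 𝟙 (does (P? x)) * 1)      ≡⟨ ∑-cong (λ x → *-identityʳ (𝟙 (does (P? x)))) xs ⟩
    ∑ xs (λ x → 𝟙 (does (P? x)))          ∎
    where open ≡-Reasoning

  ∑³-cong : ∀ {f g : A → A → A → ℕ} → (∀ x y z → f x y z ≡ g x y z) → ∀ xs → ∑³ xs f ≡ ∑³ xs g
  ∑³-cong f≗g xs = ∑-cong (λ x → ∑-cong (λ y → ∑-cong (f≗g x y) xs) xs) xs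

∏ : {A : Set} {t : ℕ} → Vec A t → (A → ℕ) → ℕ
∏ []      f = 1
∏ (x ∷ v) f = f x * ∏ v f

successes : {A : Set} {t : ℕ} → (A → Bool) → Vec A t → ℕ
successes p []      = 0
successes p (x ∷ v) = 𝟙 (p x) + successes p v

module _ {A : Set} where

  ∑-allVecs-suc : ∀ t (f : Vec A (suc t) → ℕ) xs →
                  ∑ (allVecs (suc t) xs) f ≡ ∑ xs (λ x → ∑ (allVecs t xs) (λ v → f (x ∷ v)))
  ∑-allVecs-suc t f xs =
    trans (∑-concatMap f _ xs) (∑-cong (λ x → ∑-map f (x ∷_) (allVecs t xs)) xs)

  ∑-allVecs-∏ : ∀ t (f : A → ℕ) xs → ∑ (allVecs t xs) (λ v → ∏ v f) ≡ ∑ xs f ^ t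
  ∑-allVecs-∏ zero    f xs = refl
  ∑-allVecs-∏ (suc t) f xs = begin
    ∑ (allVecs (suc t) xs) (λ v → ∏ v f)                   ≡⟨ ∑-allVecs-suc t _ xs ⟩
    ∑ xs (λ x → ∑ (allVecs t xs) (λ v → f x * ∏ v f))     ≡⟨ ∑-cong (λ x → ∑-*ˡ (f x) _ (allVecs t xs)) xs ⟩
    ∑ xs (λ x → f x * ∑ (allVecs t xs) (λ v → ∏ v f))     ≡⟨ ∑-*ʳ _ f xs ⟩
    ∑ xs f * ∑ (allVecs t xs) (λ v → ∏ v f)               ≡⟨ cong (∑ xs f *_) (∑-allVecs-∏ t f xs) ⟩
    ∑ xs f * ∑ xs f ^ t                                    ∎
    where open ≡-Reasoning

  length-allVecs : ∀ t (xs : List A) → length (allVecs t xs) ≡ length xs ^ t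
  length-allVecs t xs = begin
    length (allVecs t xs)               ≡⟨ length≡∑1 (allVecs t xs) ⟩
    ∑ (allVecs t xs) (λ _ → 1)          ≡⟨ ∑-cong ∏1≡1 (allVecs t xs) ⟨
    ∑ (allVecs t xs) (λ v → ∏ v (λ _ → 1)) ≡⟨ ∑-allVecs-∏ t _ xs ⟩
    ∑ xs (λ _ → 1) ^ t                  ≡⟨ cong (_^ t) (length≡∑1 xs) ⟨
    length xs ^ t                       ∎
    where
      open ≡-Reasoning
      ∏1≡1 : ∀ {t} (v : Vec A t) → ∏ v (λ _ → 1) ≡ 1
      ∏1≡1 []      = refl
      ∏1≡1 (x ∷ v) = trans (+-identityʳ (∏ v _)) (∏1≡1 v)

  2^t≡2^successes*∏ : ∀ (p : A → Bool) {t} (v : Vec A t) →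
                      2 ^ t ≡ 2 ^ successes p v * ∏ v (λ x → 2 ^ 𝟙 (not (p x)))
  2^t≡2^successes*∏ p []      = refl
  2^t≡2^successes*∏ p (x ∷ v) with p x
  ... | true  = trans (cong (2 *_) (2^t≡2^successes*∏ p v)) (success (2 ^ successes p v) _)
    where
      success : ∀ m n → 2 * (m * n) ≡ 2 * m * (1 * n)
      success = solve-∀
  ... | false = trans (cong (2 *_) (2^t≡2^successes*∏ p v)) (x∙yz≈y∙xz 2 (2 ^ successes p v) _)

  -- Markov's inequality for the weight 2^(number of failures), whose sum over
  -- all sequences factorises.
  chernoff : ∀ (p : A → Bool) xs t m →
             ∑ (allVecs t xs) (λ v → 𝟙 (not (does (suc m ≤? successes p v)))) * 2 ^ t
               ≤ 2 ^ m * ∑ xs (λ x → 2 ^ 𝟙 (not (p x))) ^ t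
  chernoff p xs t m = begin
    ∑ V (λ v → 𝟙 (few v)) * 2 ^ t    ≡⟨ ∑-*ʳ (2 ^ t) _ V ⟨
    ∑ V (λ v → 𝟙 (few v) * 2 ^ t)    ≤⟨ ∑-mono-≤ few⇒2^t≤2^m*∏ V ⟩
    ∑ V (λ v → 2 ^ m * ∏ v weight)   ≡⟨ ∑-*ˡ (2 ^ m) _ V ⟩
    2 ^ m * ∑ V (λ v → ∏ v weight)   ≡⟨ cong (2 ^ m *_) (∑-allVecs-∏ t weight xs) ⟩
    2 ^ m * ∑ xs weight ^ t          ∎
    where
      open ≤-Reasoning
      V = allVecs t xs
      few : Vec A t → Bool
      few v = not (does (suc m ≤? successes p v))
      weight : A → ℕ
      weight x = 2 ^ 𝟙 (not (p x))
      few⇒2^t≤2^m*∏ : ∀ v → 𝟙 (not (does (suc m ≤? successes p v))) * 2 ^ t ≤ 2 ^ m * ∏ v weight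
      few⇒2^t≤2^m*∏ v with m <ᵇ successes p v in m<ᵇs
      ... | true  = z≤n
      ... | false = begin
        1 * 2 ^ t                       ≡⟨ *-identityˡ (2 ^ t) ⟩
        2 ^ t                           ≡⟨ 2^t≡2^successes*∏ p v ⟩
        2 ^ successes p v * ∏ v weight  ≤⟨ *-monoˡ-≤ (∏ v weight) (^-monoʳ-≤ 2 s≤m) ⟩
        2 ^ m * ∏ v weight              ∎
        where
          s≤m : successes p v ≤ m
          s≤m = ≮⇒≥ λ m<s → subst T m<ᵇs (<⇒<ᵇ m<s)

  failure-weight-sum : ∀ (p : A → Bool) xs →
    ∑ xs (λ x → 2 ^ 𝟙 (not (p x))) + ∑ xs (λ x → 𝟙 (p x)) ≡ 2 * length xs
  failure-weight-sum p xs = begin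
    ∑ xs (λ x → 2 ^ 𝟙 (not (p x))) + ∑ xs (λ x → 𝟙 (p x))  ≡⟨ ∑-+ _ _ xs ⟨
    ∑ xs (λ x → 2 ^ 𝟙 (not (p x)) + 𝟙 (p x))             ≡⟨ ∑-cong (λ x → two (p x)) xs ⟩
    ∑ xs (λ _ → 2)                                        ≡⟨ ∑-const 2 xs ⟩
    length xs * 2                                         ≡⟨ *-comm (length xs) 2 ⟩
    2 * length xs                                         ∎
    where
      open ≡-Reasoning
      two : ∀ c → 2 ^ 𝟙 (not c) + 𝟙 c ≡ 2
      two true  = refl
      two false = refl

  failure-weight-sum-64 : ∀ (p : A → Bool) xs → 64 * ∑ xs (λ x → 𝟙 (p x)) ≡ length xs →
    64 * ∑ xs (λ x → 2 ^ 𝟙 (not (p x))) ≡ 127 * length xs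
  failure-weight-sum-64 p xs density = +-cancelʳ-≡ n (64 * W) (127 * n) (begin
    64 * W + n                 ≡⟨ cong (64 * W +_) density ⟨
    64 * W + 64 * S            ≡⟨ *-distribˡ-+ 64 W S ⟨
    64 * (W + S)               ≡⟨ cong (64 *_) (failure-weight-sum p xs) ⟩
    64 * (2 * n)               ≡⟨ split n ⟩
    127 * n + n                ∎)
    where
      open ≡-Reasoning
      n = length xs
      W = ∑ xs (λ x → 2 ^ 𝟙 (not (p x)))
      S = ∑ xs (λ x → 𝟙 (p x))
      split : ∀ n → 64 * (2 * n) ≡ 127 * n + n
      split = solve-∀

  few-successes-rare : ∀ (p : A → Bool) xs w t m →
    64 * ∑ xs (λ x → 𝟙 (p x)) ≡ length xs → 2 ^ m ≤ w → w ^ 3 * 127 ^ t ≤ 128 ^ t →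
    w ^ 2 * ∑ (allVecs t xs) (λ v → 𝟙 (not (does (suc m ≤? successes p v)))) ≤ length xs ^ t
  few-successes-rare p xs w t m density 2^m≤w w^3*127^t≤128^t =
    *-cancelʳ-≤ (w ^ 2 * few) (n ^ t) (128 ^ t) {{m^n≢0 128 t}} (begin
      w ^ 2 * few * 128 ^ t             ≡⟨ cong (w ^ 2 * few *_) (^-distribʳ-* 2 64 t) ⟩
      w ^ 2 * few * (2 ^ t * 64 ^ t)    ≡⟨ regroup (w ^ 2) few (2 ^ t) (64 ^ t) ⟩
      w ^ 2 * (few * 2 ^ t) * 64 ^ t    ≤⟨ *-monoˡ-≤ (64 ^ t) (*-monoʳ-≤ (w ^ 2) (chernoff p xs t m)) ⟩
      w ^ 2 * (2 ^ m * W ^ t) * 64 ^ t  ≤⟨ *-monoˡ-≤ (64 ^ t) (*-monoʳ-≤ (w ^ 2) (*-monoˡ-≤ (W ^ t) 2^m≤w)) ⟩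
      w ^ 2 * (w * W ^ t) * 64 ^ t      ≡⟨ collect w (W ^ t) (64 ^ t) ⟩
      w ^ 3 * (64 ^ t * W ^ t)          ≡⟨ cong (w ^ 3 *_) (^-distribʳ-* 64 W t) ⟨
      w ^ 3 * (64 * W) ^ t              ≡⟨ cong (λ u → w ^ 3 * u ^ t) (failure-weight-sum-64 p xs density) ⟩
      w ^ 3 * (127 * n) ^ t             ≡⟨ cong (w ^ 3 *_) (^-distribʳ-* 127 n t) ⟩
      w ^ 3 * (127 ^ t * n ^ t)         ≡⟨ *-assoc (w ^ 3) (127 ^ t) (n ^ t) ⟨
      w ^ 3 * 127 ^ t * n ^ t           ≤⟨ *-monoˡ-≤ (n ^ t) w^3*127^t≤128^t ⟩
      128 ^ t * n ^ t                   ≡⟨ *-comm (128 ^ t) (n ^ t) ⟩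
      n ^ t * 128 ^ t                   ∎)
    where
      open ≤-Reasoning
      n = length xs
      few = ∑ (allVecs t xs) (λ v → 𝟙 (not (does (suc m ≤? successes p v))))
      W = ∑ xs (λ x → 2 ^ 𝟙 (not (p x)))
      regroup : ∀ q f u v → q * f * (u * v) ≡ q * (f * u) * v
      regroup = solve-∀
      collect : ∀ w e u → w * (w * 1) * (w * e) * u ≡ w * (w * (w * 1)) * (u * e)
      collect = solve-∀

  length-allFuns-suc : ∀ (xs : List A) n → length (allFuns (suc n) xs) ≡ length xs * length (allFuns n xs)
  length-allFuns-suc xs n = begin
    length (allFuns (suc n) xs)       ≡⟨ length≡∑1 (allFuns (suc n) xs) ⟩
    ∑ (allFuns (suc n) xs) (λ _ → 1)  ≡⟨ trans (∑-concatMap _ _ xs) (∑-cong (λ y → ∑-map _ _ L) xs) ⟩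
    ∑ xs (λ _ → ∑ L (λ _ → 1))        ≡⟨ ∑-cong (λ _ → length≡∑1 L) xs ⟨
    ∑ xs (λ _ → length L)             ≡⟨ ∑-const (length L) xs ⟩
    length xs * length L              ∎
    where
      open ≡-Reasoning
      L = allFuns n xs

  ∑-allFuns-coordinate : ∀ (g : A → ℕ) xs n (j : Fin n) →
                         length xs * ∑ (allFuns n xs) (λ f → g (f j)) ≡ ∑ xs g * length (allFuns n xs)
  ∑-allFuns-coordinate g xs (suc n) zero = begin
    length xs * ∑ (allFuns (suc n) xs) (λ f → g (f zero))  ≡⟨ cong (length xs *_)
                                                                (trans (∑-concatMap _ _ xs) (∑-cong (λ y → ∑-map _ _ L) xs)) ⟩
    length xs * ∑ xs (λ y → ∑ L (λ _ → g y))               ≡⟨ cong (length xs *_) (∑-cong (λ y → ∑-const (g y) L) xs) ⟩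
    length xs * ∑ xs (λ y → length L * g y)                ≡⟨ cong (length xs *_) (∑-*ˡ (length L) g xs) ⟩
    length xs * (length L * ∑ xs g)                        ≡⟨ cong (length xs *_) (*-comm (length L) (∑ xs g)) ⟩
    length xs * (∑ xs g * length L)                        ≡⟨ x∙yz≈y∙xz (length xs) (∑ xs g) (length L) ⟩
    ∑ xs g * (length xs * length L)                        ≡⟨ cong (∑ xs g *_) (length-allFuns-suc xs n) ⟨
    ∑ xs g * length (allFuns (suc n) xs)                   ∎
    where
      open ≡-Reasoning
      L = allFuns n xs
  ∑-allFuns-coordinate g xs (suc n) (suc j) = begin
    length xs * ∑ (allFuns (suc n) xs) (λ f → g (f (suc j)))  ≡⟨ cong (length xs *_)
                                                                   (trans (∑-concatMap _ _ xs) (∑-cong (λ y → ∑-map _ _ L) xs)) ⟩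
    length xs * ∑ xs (λ _ → C)                                ≡⟨ cong (length xs *_) (∑-const C xs) ⟩
    length xs * (length xs * C)                               ≡⟨ cong (length xs *_) (∑-allFuns-coordinate g xs n j) ⟩
    length xs * (∑ xs g * length L)                           ≡⟨ x∙yz≈y∙xz (length xs) (∑ xs g) (length L) ⟩
    ∑ xs g * (length xs * length L)                           ≡⟨ cong (∑ xs g *_) (length-allFuns-suc xs n) ⟨
    ∑ xs g * length (allFuns (suc n) xs)                      ∎
    where
      open ≡-Reasoning
      L = allFuns n xs
      C = ∑ L (λ f → g (f j))

labellings : (w : ℕ) → List (Labelling w)
labellings w = allFuns w allSideFuns

both-sides-probability : ∀ {w} (j : Fin w) (y : AB) →
  4 * ∑ (labellings w) (λ f → 𝟙 (does (f j a ≟AB y) ∧ does (f j b ≟AB y))) ≡ length (labellings w)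
both-sides-probability {w} j y =
  trans (∑-allFuns-coordinate (both y) allSideFuns w j)
        (trans (cong (_* length (labellings w)) (one-pattern y)) (*-identityˡ _))
  where
    both : AB → (Side → AB) → ℕ
    both y u = 𝟙 (does (u a ≟AB y) ∧ does (u b ≟AB y))
    one-pattern : ∀ y → ∑ allSideFuns (both y) ≡ 1
    one-pattern α = refl
    one-pattern β = refl

clean-probability : ∀ {w} (xv : Fin w → Bool) (s : Fin w → Fin w) (j : Fin w) →
  64 * ∑³ (labellings w) (λ l m r → 𝟙 (does (clean? (blk xv s l m r) j))) ≡ length (labellings w) ^ 3
clean-probability {w} xv s j = begin
  64 * ∑³ labs (λ l m r → 𝟙 (bothβ l ∧ (bothα m ∧ bothβ r)))       ≡⟨ cong (64 *_) (∑³-cong split labs) ⟩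
  64 * ∑³ labs (λ l m r → 𝟙 (bothβ l) * (𝟙 (bothα m) * 𝟙 (bothβ r))) ≡⟨ cong (64 *_) (∑³-* _ _ _ labs) ⟩
  64 * (Sβ * (Sα * Sβ))                                              ≡⟨ spread Sβ Sα ⟩
  (4 * Sβ) * ((4 * Sα) * (4 * Sβ))                                    ≡⟨ cong₂ (λ u v → u * (v * u))
                                                                        (both-sides-probability j β) (both-sides-probability j α) ⟩
  L * (L * L)                                                         ≡⟨ cong (λ u → L * (L * u)) (*-identityʳ L) ⟨
  L ^ 3                                                               ∎
  where
    open ≡-Reasoning
    labs = labellings w
    L = length labs
    bothβ bothα : Labelling w → Bool
    bothβ f = does (f j a ≟AB β) ∧ does (f j b ≟AB β)
    bothα f = does (f j a ≟AB α) ∧ does (f j b ≟AB α)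
    Sβ = ∑ labs (λ f → 𝟙 (bothβ f))
    Sα = ∑ labs (λ f → 𝟙 (bothα f))
    split : ∀ l m r → 𝟙 (bothβ l ∧ (bothα m ∧ bothβ r)) ≡ 𝟙 (bothβ l) * (𝟙 (bothα m) * 𝟙 (bothβ r))
    split l m r = trans (𝟙-∧ (bothβ l) _) (cong (𝟙 (bothβ l) *_) (𝟙-∧ (bothα m) (bothβ r)))
    spread : ∀ p q → 64 * (p * (q * p)) ≡ (4 * p) * ((4 * q) * (4 * p))
    spread = solve-∀

∑-allBlocks : ∀ {w} (F : BlockData w → ℕ) →
  ∑ (allBlocks w) F ≡ ∑ (allFuns w (true ∷ false ∷ [])) λ xv → ∑ (allFuns w (allFin w)) λ s →
                        ∑³ (labellings w) (λ l m r → F (blk xv s l m r))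
∑-allBlocks {w} F =
  trans (∑-concatMap F (λ xv → concatMap (triples xv) perms) bits) (∑-cong (λ xv →
  trans (∑-concatMap F (triples xv) perms) (∑-cong (λ s →
  trans (∑-concatMap F (λ l → concatMap (λ m → map (blk xv s l m) labs) labs) labs) (∑-cong (λ l →
  trans (∑-concatMap F (λ m → map (blk xv s l m) labs) labs) (∑-cong (λ m →
  ∑-map F (blk xv s l m) labs) labs)) labs)) perms)) bits)
  where
    bits = allFuns w (true ∷ false ∷ [])
    perms = allFuns w (allFin w)
    labs = labellings w
    triples : (Fin w → Bool) → (Fin w → Fin w) → List (BlockData w)
    triples xv s = concatMap (λ l → concatMap (λ m → map (blk xv s l m) labs) labs) labs

isPermBlock : ∀ {w} → BlockData w → Bool
isPermBlock B = does (isPerm? (σ B))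

isActive : ∀ {w} → 2 ≤ w → BlockData w → Bool
isActive h B = does (active? h B)

permBlocks : (w : ℕ) → List (BlockData w)
permBlocks w = filter (λ B → isPerm? (σ B)) (allBlocks w)

active-labellings : ∀ {w} (h : 2 ≤ w) xv s →
  64 * ∑³ (labellings w) (λ l m r → 𝟙 (isPermBlock (blk xv s l m r)) * 𝟙 (isActive h (blk xv s l m r)))
    ≡ ∑³ (labellings w) (λ l m r → 𝟙 (isPermBlock (blk xv s l m r)))
active-labellings {w} h xv s = begin
  64 * ∑³ labs (λ l m r → c * active l m r)      ≡⟨ cong (64 *_) (∑³-*ˡ c active labs) ⟩
  64 * (c * ∑³ labs active)                      ≡⟨ x∙yz≈y∙xz 64 c (∑³ labs active) ⟩
  c * (64 * ∑³ labs active)                      ≡⟨ cong (c *_) (clean-probability xv s (s (one h))) ⟩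
  c * length labs ^ 3                            ≡⟨ ∑³-const c labs ⟨
  ∑³ labs (λ _ _ _ → c)                          ∎
  where
    open ≡-Reasoning
    labs = labellings w
    c = 𝟙 (does (isPerm? s))
    active : Labelling w → Labelling w → Labelling w → ℕ
    active l m r = 𝟙 (isActive h (blk xv s l m r))

active-density : ∀ {w} (h : 2 ≤ w) → 64 * ∑ (permBlocks w) (λ B → 𝟙 (isActive h B)) ≡ length (permBlocks w)
active-density {w} h = begin
  64 * ∑ (permBlocks w) (λ B → 𝟙 (isActive h B))                      ≡⟨ cong (64 *_) (∑-filter _ _ (allBlocks w)) ⟩
  64 * ∑ (allBlocks w) (λ B → 𝟙 (isPermBlock B) * 𝟙 (isActive h B))  ≡⟨ cong (64 *_) (∑-allBlocks permActive) ⟩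
  64 * ∑ bits (λ xv → ∑ perms (λ s → ∑³ labs (λ l m r → permActive (blk xv s l m r))))
    ≡⟨ trans (∑-cong (λ xv → ∑-*ˡ 64 _ perms) bits) (∑-*ˡ 64 _ bits) ⟨
  ∑ bits (λ xv → ∑ perms (λ s → 64 * ∑³ labs (λ l m r → permActive (blk xv s l m r))))
    ≡⟨ ∑-cong (λ xv → ∑-cong (active-labellings h xv) perms) bits ⟩
  ∑ bits (λ xv → ∑ perms (λ s → ∑³ labs (λ l m r → 𝟙 (isPermBlock (blk xv s l m r)))))
    ≡⟨ ∑-allBlocks {w} (λ B → 𝟙 (isPermBlock B)) ⟨
  ∑ (allBlocks w) (λ B → 𝟙 (isPermBlock B))                           ≡⟨ length-filter≡∑𝟙 _ (allBlocks w) ⟨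
  length (permBlocks w)                                               ∎
  where
    open ≡-Reasoning
    bits = allFuns w (true ∷ false ∷ [])
    perms = allFuns w (allFin w)
    labs = labellings w
    permActive : BlockData w → ℕ
    permActive B = 𝟙 (isPermBlock B) * 𝟙 (isActive h B)

filter-allPerm-map-∷ : ∀ {w t} (B : BlockData w) (V : List (Vec (BlockData w) t)) →
  filter allPerm? (map (B ∷_) V) ≡ (if isPermBlock B then map (B ∷_) (filter allPerm? V) else [])
filter-allPerm-map-∷ B [] with isPermBlock B
... | true  = refl
... | false = refl
filter-allPerm-map-∷ B (v ∷ V) with isPermBlock B | filter-allPerm-map-∷ B V
... | false | ih = ih
... | true  | ih with does (allPerm? v)
...   | true  = cong ((B ∷ v) ∷_) ih
...   | false = ih

filter-allPerm-allVecs : ∀ {w} t (xs : List (BlockData w)) →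
  filter allPerm? (allVecs t xs) ≡ allVecs t (filter (λ B → isPerm? (σ B)) xs)
filter-allPerm-allVecs zero    xs = refl
filter-allPerm-allVecs (suc t) xs =
  trans (filter-concatMap xs)
        (cong (λ V → concatMap (λ B → map (B ∷_) V) (filter (λ B → isPerm? (σ B)) xs))
              (filter-allPerm-allVecs t xs))
  where
    V = allVecs t xs
    filter-concatMap : ∀ ys → filter allPerm? (concatMap (λ B → map (B ∷_) V) ys)
                            ≡ concatMap (λ B → map (B ∷_) (filter allPerm? V)) (filter (λ B → isPerm? (σ B)) ys)
    filter-concatMap []       = refl
    filter-concatMap (B ∷ ys) with isPermBlock B in perm | filter-allPerm-map-∷ B V
    ... | true  | head = trans (filter-++ allPerm? (map (B ∷_) V) _) (cong₂ _++_ head (filter-concatMap ys))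
    ... | false | head = trans (filter-++ allPerm? (map (B ∷_) V) _) (cong₂ _++_ head (filter-concatMap ys))

outcomes≡allVecs-permBlocks : ∀ w t → outcomes w t ≡ allVecs t (permBlocks w)
outcomes≡allVecs-permBlocks w t = filter-allPerm-allVecs t (allBlocks w)

numActive-∷ : ∀ {w t} (h : 2 ≤ w) B (Bs : Vec (BlockData w) t) →
              numActive h (B ∷ Bs) ≡ 𝟙 (isActive h B) + numActive h Bs
numActive-∷ h B Bs with active? h B
... | yes active   = cong (λ c → 𝟙 c + numActive h Bs) (sym (dec-true (active? h B) active))
... | no  inactive = cong (λ c → 𝟙 c + numActive h Bs) (sym (dec-false (active? h B) inactive))

numActive≡successes : ∀ {w t} (h : 2 ≤ w) (Bs : Vec (BlockData w) t) → numActive h Bs ≡ successes (isActive h) Bs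
numActive≡successes h []       = refl
numActive≡successes h (B ∷ Bs) = trans (numActive-∷ h B Bs) (cong (𝟙 (isActive h B) +_) (numActive≡successes h Bs))

complement-bound : ∀ q good bad total → good + bad ≡ total → q * bad ≤ total → (q ∸ 1) * total ≤ q * good
complement-bound q good bad total split q*bad≤total = begin
  (q ∸ 1) * total          ≡⟨ *-distribʳ-∸ total q 1 ⟩
  q * total ∸ 1 * total    ≤⟨ m≤n+o⇒m∸n≤o (q * total) (1 * total) (begin
    q * total                ≡⟨ cong (q *_) split ⟨
    q * (good + bad)         ≡⟨ *-distribˡ-+ q good bad ⟩
    q * good + q * bad       ≤⟨ +-monoʳ-≤ (q * good) q*bad≤total ⟩
    q * good + total         ≡⟨ +-comm (q * good) total ⟩
    total + q * good         ≡⟨ cong (_+ q * good) (*-identityˡ total) ⟨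
    1 * total + q * good     ∎) ⟩
  q * good                 ∎
  where open ≤-Reasoning

few-active-rare : ∀ w t (h : 2 ≤ w) k → LnAtMost (w ^ 512) t → (∀ j → j < k → ¬ LnAtMost w j) →
  w ^ 2 * ∑ (allVecs t (permBlocks w)) (λ v → 𝟙 (not (does (k ≤? successes (isActive h) v))))
    ≤ length (permBlocks w) ^ t
few-active-rare w t h zero    _     _    = ≤-trans (≤-reflexive none) z≤n
  where
    V = allVecs t (permBlocks w)
    none : w ^ 2 * ∑ V (λ _ → 0) ≡ 0
    none = trans (cong (w ^ 2 *_) (trans (∑-const 0 V) (*-zeroʳ (length V)))) (*-zeroʳ (w ^ 2))
few-active-rare w t h (suc m) ln512 minimal =
  few-successes-rare (isActive h) (permBlocks w) w t m (active-density h)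
    (<⇒≤ (¬LnAtMost⇒2^k<m w m (minimal m ≤-refl))) (LnAtMost⇒w^3*127^t≤128^t w t ln512)

goodCount≡∑ : ∀ w t (h : 2 ≤ w) k →
  goodCount w t h k ≡ ∑ (allVecs t (permBlocks w)) (λ v → 𝟙 (does (k ≤? successes (isActive h) v)))
goodCount≡∑ w t h k = begin
  goodCount w t h k                                        ≡⟨ cong (λ l → length (filter (λ v → k ≤? numActive h v) l))
                                                                (outcomes≡allVecs-permBlocks w t) ⟩
  length (filter (λ v → k ≤? numActive h v) V)             ≡⟨ length-filter≡∑𝟙 _ V ⟩
  ∑ V (λ v → 𝟙 (does (k ≤? numActive h v)))                ≡⟨ ∑-cong (λ v → cong (λ n → 𝟙 (does (k ≤? n))) (numActive≡successes h v)) V ⟩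
  ∑ V (λ v → 𝟙 (does (k ≤? successes (isActive h) v)))     ∎
  where
    open ≡-Reasoning
    V = allVecs t (permBlocks w)

lemma4p5 : (w t : ℕ) (h : 2 ≤ w) → LnAtMost (w ^ 512) t →
           (k : ℕ) → LnAtMost w k → (∀ j → j < k → ¬ LnAtMost w j) →
           (w ^ 2 ∸ 1) * length (outcomes w t) ≤ w ^ 2 * goodCount w t h k
lemma4p5 w t h ln512 k _ minimal = begin
  (w ^ 2 ∸ 1) * length (outcomes w t)  ≡⟨ cong (λ l → (w ^ 2 ∸ 1) * length l) (outcomes≡allVecs-permBlocks w t) ⟩
  (w ^ 2 ∸ 1) * length V               ≤⟨ complement-bound (w ^ 2) good bad (length V) (∑𝟙+∑𝟙-not enough V) bad-rare ⟩
  w ^ 2 * good                         ≡⟨ cong (w ^ 2 *_) (goodCount≡∑ w t h k) ⟨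
  w ^ 2 * goodCount w t h k            ∎
  where
    open ≤-Reasoning
    V = allVecs t (permBlocks w)
    enough : Vec (BlockData w) t → Bool
    enough v = does (k ≤? successes (isActive h) v)
    good = ∑ V (λ v → 𝟙 (enough v))
    bad = ∑ V (λ v → 𝟙 (not (enough v)))
    bad-rare : w ^ 2 * bad ≤ length V
    bad-rare = subst (w ^ 2 * bad ≤_) (sym (length-allVecs t (permBlocks w))) (few-active-rare w t h k ln512 minimal)
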